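{- Let $G$ be a finite impartial game with set of positions $X$ and move set $M$, and let $\mathcal N$ and $\mathcal P$ be its sets of N- and P-positions. Let $G'$ be the game on the same positions with move set $M'=M\cup E$, where $E$ is a set of additional moves with $M\cap E=\emptyset$, and assume $G'$ is also a finite impartial game. Suppose there exists $Q\subseteq\mathcal P$ such that: (1) there is no move in $E$ from an element of $\mathcal P\setminus Q$ to an element of $\mathcal P\setminus Q$; (2) for every $\mathbf p\in\mathcal N$ that has a move in $M$ to a position in $Q$, there exists a move in $M'$ from $\mathbf p$ to a position in $\mathcal P\setminus Q$; (3) from every position $\mathbf p\in Q$ there is a move in $E$ to a position in $\mathcal P\setminus Q$. Then $\mathcal N\cup Q$ and $\mathcal P\setminus Q$ are the sets of N- and P-positions, respectively, of $G'$.
   Context: A finite impartial game is given by a set of positions and a set of moves (ordered pairs $(x,y)$ meaning one may move from $x$ to $y$), available to both players, such that every sequence of moves is finite. Players alternate moves and a player unable to move loses (normal play). A P-position is one from which the player to move loses under optimal play; an N-position is one from which the player to move wins. -}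

module Defs where

open import Level using (0ℓ)
open import Data.Product using (Σ; _×_)
open import Data.Sum using (_⊎_)
open import Relation.Unary using (Pred)
open import Relation.Binary using (Rel)
open import Induction.WellFounded using (WellFounded)

Moves : Set → Set₁
Moves X = Rel X 0ℓ

-- "Every sequence of moves is finite": the converse of the move relation
-- is well-founded (no infinite chain x₀ → x₁ → x₂ → …).
IsFiniteGame : {X : Set} → Moves X → Set
IsFiniteGame {X} M = WellFounded (λ y x → M x y)

_∪M_ : {X : Set} → Moves X → Moves X → Moves X
(M ∪M E) x y = M x y ⊎ E x y

-- N- and P-positions under normal play (player unable to move loses):
-- x is an N-position iff some move leads to a P-position;
-- x is a P-position iff every move leads to an N-position.
mutual
  data NPos {X : Set} (M : Moves X) : Pred X 0ℓ where
    win : ∀ {x} y → M x y → PPos M y → NPos M x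

  data PPos {X : Set} (M : Moves X) : Pred X 0ℓ where
    lose : ∀ {x} → (∀ y → M x y → NPos M y) → PPos M x

-- Over the new move set M ∪ E, label N ∪ Q as winning and P ∖ Q as losing.
-- The labels cover all positions, every winning position has a move to a
-- losing one (an M-move into P ∖ Q, or hypotheses (2) and (3) when the obvious
-- target lies in Q), and every move from a losing position reaches a winning
-- one (M-moves by the outcome theory of M, E-moves by hypothesis (1)). In a
-- finite game such a labelling is necessarily the true N/P partition.
module Submission where

open import Defs
open import Data.Product using (_×_; ∃; _,_)
open import Data.Sum using (_⊎_; inj₁; inj₂)
open import Data.Empty using (⊥; ⊥-elim)
open import Relation.Nullary using (¬_; yes; no)
open import Relation.Unary using (Pred)
open import Function.Bundles using (_⇔_; mk⇔)
open import Axiom.ExcludedMiddle using (ExcludedMiddle)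
open import Level using (0ℓ)
open import Induction.WellFounded using (Acc; acc)

NPos⇒¬PPos : {X : Set} {M : Moves X} {x : X} → NPos M x → ¬ PPos M x
NPos⇒¬PPos (win y m py) (lose f) = NPos⇒¬PPos (f y m) py

NPos⊎PPos : ExcludedMiddle 0ℓ → {X : Set} {M : Moves X} →
  IsFiniteGame M → ∀ x → NPos M x ⊎ PPos M x
NPos⊎PPos em {M = M} wf x = go x (wf x)
  where
  go : ∀ x → Acc (λ y x → M x y) x → NPos M x ⊎ PPos M x
  go x (acc rs) with em {∃ λ y → M x y × PPos M y}
  ... | yes (y , m , py) = inj₁ (win y m py)
  ... | no ¬move-to-P = inj₂ (lose λ y m → NPos-of y m (go y (rs m)))
    where
    NPos-of : ∀ y → M x y → NPos M y ⊎ PPos M y → NPos M y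
    NPos-of y m (inj₁ ny) = ny
    NPos-of y m (inj₂ py) = ⊥-elim (¬move-to-P (y , m , py))

module OutcomeLabelling {X : Set} {M : Moves X} (wf : IsFiniteGame M) (N P : Pred X 0ℓ)
  (N⇒move-to-P : ∀ {x} → N x → ∃ λ y → M x y × P y)
  (P⇒moves-to-N : ∀ {x} → P x → ∀ y → M x y → N y) where

  private
    mutual
      N⇒NPos′ : ∀ {x} → Acc (λ y x → M x y) x → N x → NPos M x
      N⇒NPos′ (acc rs) nx with N⇒move-to-P nx
      ... | y , m , py = win y m (P⇒PPos′ (rs m) py)

      P⇒PPos′ : ∀ {x} → Acc (λ y x → M x y) x → P x → PPos M x
      P⇒PPos′ (acc rs) px = lose λ y m → N⇒NPos′ (rs m) (P⇒moves-to-N px y m)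

  N⇒NPos : ∀ {x} → N x → NPos M x
  N⇒NPos {x} = N⇒NPos′ (wf x)

  P⇒PPos : ∀ {x} → P x → PPos M x
  P⇒PPos {x} = P⇒PPos′ (wf x)

  outcomes-characterised : (∀ x → N x ⊎ P x) →
    ∀ x → (NPos M x ⇔ N x) × (PPos M x ⇔ P x)
  outcomes-characterised N⊎P x = mk⇔ NPos⇒N N⇒NPos , mk⇔ PPos⇒P P⇒PPos
    where
    NPos⇒N : NPos M x → N x
    NPos⇒N nx with N⊎P x
    ... | inj₁ n = n
    ... | inj₂ p = ⊥-elim (NPos⇒¬PPos nx (P⇒PPos p))

    PPos⇒P : PPos M x → P x
    PPos⇒P px with N⊎P x
    ... | inj₁ n = ⊥-elim (NPos⇒¬PPos (N⇒NPos n) px)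
    ... | inj₂ p = p

module ExtendedGame (em : ExcludedMiddle 0ℓ) {X : Set} (M E : Moves X)
  (wfM : IsFiniteGame M) (Q : X → Set)
  (no-E-inside-P∖Q : ∀ x y → E x y → PPos M x → ¬ Q x → PPos M y → ¬ Q y → ⊥)
  (redirect : ∀ x → NPos M x → (∃ λ y → M x y × Q y) →
    ∃ λ y → (M ∪M E) x y × PPos M y × ¬ Q y)
  (escape : ∀ x → Q x → ∃ λ y → E x y × PPos M y × ¬ Q y) where

  Winning Losing : Pred X 0ℓ
  Winning x = NPos M x ⊎ Q x
  Losing x = PPos M x × ¬ Q x

  Winning⊎Losing : ∀ x → Winning x ⊎ Losing x
  Winning⊎Losing x with NPos⊎PPos em wfM x | em {Q x}
  ... | inj₁ nx | _      = inj₁ (inj₁ nx)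
  ... | inj₂ _  | yes qx = inj₁ (inj₂ qx)
  ... | inj₂ px | no ¬qx = inj₂ (px , ¬qx)

  Winning⇒move-to-Losing : ∀ {x} → Winning x →
    ∃ λ y → (M ∪M E) x y × Losing y
  Winning⇒move-to-Losing {x} (inj₁ nx@(win y m py)) with em {Q y}
  ... | yes qy = redirect x nx (y , m , qy)
  ... | no ¬qy = y , inj₁ m , py , ¬qy
  Winning⇒move-to-Losing {x} (inj₂ qx) with escape x qx
  ... | y , e , py , ¬qy = y , inj₂ e , py , ¬qy

  Losing⇒moves-to-Winning : ∀ {x} → Losing x → ∀ y → (M ∪M E) x y → Winning y
  Losing⇒moves-to-Winning (lose f , _) y (inj₁ m) = inj₁ (f y m)
  Losing⇒moves-to-Winning {x} (px , ¬qx) y (inj₂ e) with Winning⊎Losing y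
  ... | inj₁ wy = wy
  ... | inj₂ (py , ¬qy) = ⊥-elim (no-E-inside-P∖Q x y e px ¬qx py ¬qy)

proposition2 : ExcludedMiddle 0ℓ →
    {X : Set} (M E : Moves X) →
    IsFiniteGame M →
    (∀ x y → M x y → E x y → ⊥) →
    IsFiniteGame (M ∪M E) →
    (Q : X → Set) →
    (∀ x → Q x → PPos M x) →
    (∀ x y → E x y → PPos M x → ¬ Q x → PPos M y → ¬ Q y → ⊥) →
    (∀ x → NPos M x → (∃ λ y → M x y × Q y) →
    ∃ λ y → (M ∪M E) x y × PPos M y × ¬ Q y) →
    (∀ x → Q x → ∃ λ y → E x y × PPos M y × ¬ Q y) →
    ∀ x → (NPos (M ∪M E) x ⇔ (NPos M x ⊎ Q x))
    × (PPos (M ∪M E) x ⇔ (PPos M x × ¬ Q x))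
proposition2 em M E wfM _ wfM∪E Q _ h1 h2 h3 =
  outcomes-characterised wfM∪E Winning Losing
    Winning⇒move-to-Losing Losing⇒moves-to-Winning Winning⊎Losing
  where
  open OutcomeLabelling using (outcomes-characterised)
  open ExtendedGame em M E wfM Q h1 h2 h3
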